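{- For every graph $G$, $z_G=\operatorname{ft}(G)$.
   Context: All graphs are finite, simple and undirected with nonempty vertex sets. Zero forcing: given $B\subseteq V(G)$ initially filled, a filled vertex $u$ may force an unfilled vertex $w$ if $w$ is the only unfilled neighbor of $u$; $B$ is a zero forcing set if repeated forcing fills all vertices. A fort of $G$ is a nonempty $F\subseteq V(G)$ such that every $v\in V(G)\setminus F$ has $|N_G(v)\cap F|\neq 1$; $\operatorname{ft}(G)$ is the maximum number of forts in a collection of pairwise disjoint forts of $G$. A failed zero forcing partition of $G$ is a partition $\{\Pi_1,\dots,\Pi_k\}$ of $V(G)$ such that for each $i$, $V(G)\setminus\Pi_i$ is not a zero forcing set of $G$; $z_G$ is the maximum number of parts in a failed zero forcing partition of $G$. -}

module Defs where

open import Data.Nat using (ℕ; suc; _≤_)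
open import Data.Bool using (Bool; true; false)
open import Data.Fin using (Fin)
open import Data.Fin.Subset using (Subset; _∈_; _∉_; ∁; _∩_; ∣_∣; Nonempty; Empty)
open import Data.Vec using (tabulate)
open import Data.Product using (Σ; ∃; _×_)
open import Relation.Binary.PropositionalEquality using (_≡_; _≢_)
open import Relation.Nullary using (¬_)

record Graph (n : ℕ) : Set where
  field
    adj   : Fin n → Fin n → Bool
    sym   : ∀ u v → adj u v ≡ adj v u
    irrefl : ∀ v → adj v v ≡ false

open Graph public

module _ {n : ℕ} (G : Graph n) where

  N : Fin n → Subset n
  N v = tabulate (adj G v)

  -- Filled B v : v is filled after repeatedly applying the forcing rule
  -- starting from the initially filled set B (least set containing B and
  -- closed under the forcing rule: a filled u all of whose neighbours other
  -- than w are filled forces its neighbour w).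
  data Filled (B : Subset n) : Fin n → Set where
    initial : ∀ {v} → v ∈ B → Filled B v
    force   : ∀ {u w} → Filled B u → adj G u w ≡ true
            → (∀ x → adj G u x ≡ true → x ≢ w → Filled B x)
            → Filled B w

  IsZeroForcingSet : Subset n → Set
  IsZeroForcingSet B = ∀ v → Filled B v

  IsFort : Subset n → Set
  IsFort F = Nonempty F × (∀ v → v ∉ F → ∣ N v ∩ F ∣ ≢ 1)

  PairwiseDisjoint : {k : ℕ} → (Fin k → Subset n) → Set
  PairwiseDisjoint P = ∀ i j → i ≢ j → Empty (P i ∩ P j)

  HasDisjointForts : ℕ → Set
  HasDisjointForts k = Σ (Fin k → Subset n) λ F →
    (∀ i → IsFort (F i)) × PairwiseDisjoint F

  IsPartition : {k : ℕ} → (Fin k → Subset n) → Set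
  IsPartition P = (∀ i → Nonempty (P i)) × PairwiseDisjoint P × (∀ v → ∃ λ i → v ∈ P i)

  HasFailedZFPartition : ℕ → Set
  HasFailedZFPartition k = Σ (Fin k → Subset n) λ P →
    IsPartition P × (∀ i → ¬ IsZeroForcingSet (∁ (P i)))

IsMaximum : (ℕ → Set) → ℕ → Set
IsMaximum P m = P m × (∀ k → P k → k ≤ m)

z≡ : ∀ {n} → Graph n → ℕ → Set
z≡ G m = IsMaximum (HasFailedZFPartition G) m

ft≡ : ∀ {n} → Graph n → ℕ → Set
ft≡ G m = IsMaximum (HasDisjointForts G) m

-- A set B is zero forcing iff it meets every fort: a fort disjoint from B is never
-- filled, since the first fort vertex to be forced would be the only fort neighbour of
-- the vertex forcing it; conversely, the vertices left unfilled by B form a fort.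
-- Hence every part of a failed zero forcing partition contains a fort, and a family of
-- disjoint forts extends to a failed partition by putting the uncovered vertices into
-- one part. Constructively, "left unfilled" is only ¬¬-decidable; this suffices because
-- having k disjoint forts is a decidable (finitely searchable) property.
module Submission where

open import Defs
open import Data.Nat using (ℕ; zero; suc; _≤_; z≤n; s≤s) renaming (_≟_ to _≟ℕ_)
open import Data.Nat.Properties using (≤∧≢⇒<; ≤-pred; suc-injective)
open import Data.Bool using (true; false)
open import Data.Fin using (Fin; zero; suc; _≟_)
open import Data.Fin.Properties using (any?; all?; ¬∀⟶∃¬; injective⇒≤)
open import Data.Fin.Subset using (Subset; _∈_; _∉_; ∁; _∩_; ∣_∣; Nonempty; Empty; ⁅_⁆; ⊥; ⊤; _⊆_)
open import Data.Fin.Subset.Properties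
  using (_∈?_; nonempty?; anySubset?; x∈p∩q⁺; x∈p∩q⁻; x∈⁅x⁆; x∈⁅y⁆⇒x≡y; ∣⁅x⁆∣≡1;
         ⊆-antisym; ∈⊤; x∉∁p⇒x∈p; x∈∁p⇒x∉p)
open import Data.Vec using (Vec; []; _∷_; tabulate; lookup)
open import Data.Vec.Properties using (lookup∘tabulate; []=⇒lookup; lookup⇒[]=)
open import Data.Product using (∃; _×_; _,_; proj₁; proj₂)
open import Data.Empty using (⊥-elim)
open import Function using (_∘_)
open import Relation.Binary.PropositionalEquality as ≡
  using (_≡_; _≢_; refl; trans; subst; subst₂; cong; _≗_)
open import Relation.Nullary using (¬_; Dec; yes; no; does)
open import Relation.Nullary.Decidable
  using (¬?; _×-dec_; _→-dec_; map′; dec-true; decidable-stable; ¬¬-excluded-middle)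
open import Relation.Nullary.Negation using (¬¬-map; contradiction)
open import Level using (0ℓ)
open import Relation.Unary using (Pred; Decidable)

private
  variable
    n k : ℕ

∈-tabulate⁺ : ∀ {f : Fin n → _} {x} → f x ≡ true → x ∈ tabulate f
∈-tabulate⁺ {f = f} {x} fx = lookup⇒[]= x (tabulate f) (trans (lookup∘tabulate f x) fx)

∈-tabulate⁻ : ∀ {f : Fin n → _} {x} → x ∈ tabulate f → f x ≡ true
∈-tabulate⁻ {f = f} {x} x∈ = trans (≡.sym (lookup∘tabulate f x)) ([]=⇒lookup x∈)

⟦_⟧ : {P : Pred (Fin n) 0ℓ} → Decidable P → Subset n
⟦ P? ⟧ = tabulate (does ∘ P?)

∈⟦⟧⁺ : ∀ {P : Pred (Fin n) 0ℓ} (P? : Decidable P) {x} → P x → x ∈ ⟦ P? ⟧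
∈⟦⟧⁺ P? {x} px = ∈-tabulate⁺ (dec-true (P? x) px)

∈⟦⟧⁻ : ∀ {P : Pred (Fin n) 0ℓ} (P? : Decidable P) {x} → x ∈ ⟦ P? ⟧ → P x
∈⟦⟧⁻ P? {x} x∈ with P? x | ∈-tabulate⁻ {f = does ∘ P?} x∈
... | yes px | _ = px

x∈p⊆⁅x⁆⇒∣p∣≡1 : ∀ {p : Subset n} {x} → x ∈ p → p ⊆ ⁅ x ⁆ → ∣ p ∣ ≡ 1
x∈p⊆⁅x⁆⇒∣p∣≡1 {p = p} {x} x∈p p⊆⁅x⁆ = subst (λ q → ∣ q ∣ ≡ 1) (≡.sym p≡⁅x⁆) (∣⁅x⁆∣≡1 x)
  where
  p≡⁅x⁆ : p ≡ ⁅ x ⁆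
  p≡⁅x⁆ = ⊆-antisym p⊆⁅x⁆ λ y∈⁅x⁆ → subst (_∈ p) (≡.sym (x∈⁅y⁆⇒x≡y x y∈⁅x⁆)) x∈p

∣p∣≡0⇒p≡⊥ : ∀ {p : Subset n} → ∣ p ∣ ≡ 0 → p ≡ ⊥
∣p∣≡0⇒p≡⊥ {p = []}        _     = refl
∣p∣≡0⇒p≡⊥ {p = false ∷ p} |p|≡0 = cong (false ∷_) (∣p∣≡0⇒p≡⊥ |p|≡0)

∣p∣≡1⇒p≡⁅x⁆ : ∀ (p : Subset n) → ∣ p ∣ ≡ 1 → ∃ λ x → p ≡ ⁅ x ⁆
∣p∣≡1⇒p≡⁅x⁆ (true  ∷ p) |p|≡1 = zero , cong (true ∷_) (∣p∣≡0⇒p≡⊥ (suc-injective |p|≡1))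
∣p∣≡1⇒p≡⁅x⁆ (false ∷ p) |p|≡1 with ∣p∣≡1⇒p≡⁅x⁆ p |p|≡1
... | x , p≡⁅x⁆ = suc x , cong (false ∷_) p≡⁅x⁆

¬¬-∀-Fin : ∀ {P : Fin k → Set} → (∀ i → ¬ ¬ P i) → ¬ ¬ (∀ i → P i)
¬¬-∀-Fin {k = zero}  _     ¬∀P = ¬∀P (λ ())
¬¬-∀-Fin {k = suc k} ¬¬P ¬∀P = ¬¬P zero λ P₀ →
  ¬¬-∀-Fin (¬¬P ∘ suc) λ P₊ → ¬∀P λ { zero → P₀ ; (suc i) → P₊ i }

Searchable : Set → Set₁
Searchable A = ∀ {P : Pred A 0ℓ} → Decidable P → Dec (∃ P)

Vec-searchable : ∀ {A} → Searchable A → ∀ k → Searchable (Vec A k)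
Vec-searchable search zero    P? = map′ ([] ,_) (λ { ([] , p) → p }) (P? [])
Vec-searchable search (suc k) P? =
  map′ (λ (x , xs , p) → x ∷ xs , p) (λ { (x ∷ xs , p) → x , xs , p })
       (search λ x → Vec-searchable search k (P? ∘ (x ∷_)))

Fin→-searchable : ∀ {A} → Searchable A → ∀ {P : Pred (Fin k → A) 0ℓ} →
                  (∀ {f g} → f ≗ g → P f → P g) → Decidable P → Dec (∃ P)
Fin→-searchable {k = k} search resp P? =
  map′ (λ (xs , p) → lookup xs , p)
       (λ (f , p) → tabulate f , resp (≡.sym ∘ lookup∘tabulate f) p)
       (Vec-searchable search k (P? ∘ lookup))

bounded⇒maximum : ∀ {P : ℕ → Set} → Decidable P → ∀ b → (∀ {k} → P k → k ≤ b) →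
                  ∃ P → ∃ (IsMaximum P)
bounded⇒maximum P? zero    bound (k , pk) with z≤n ← bound pk = 0 , pk , λ _ → bound
bounded⇒maximum P? (suc b) bound ∃P with P? (suc b)
... | yes pb = suc b , pb , λ _ → bound
... | no ¬pb = bounded⇒maximum P? b (λ pk → ≤-pred (≤∧≢⇒< (bound pk) λ { refl → ¬pb pk })) ∃P

module _ (G : Graph n) where

  ∈N⁺ : ∀ {u v} → adj G u v ≡ true → v ∈ N G u
  ∈N⁺ = ∈-tabulate⁺

  ∈N⁻ : ∀ {u v} → v ∈ N G u → adj G u v ≡ true
  ∈N⁻ = ∈-tabulate⁻

  Filled-∁⇒∉fort : ∀ {F P} → IsFort G F → F ⊆ P → ∀ {v} → Filled G (∁ P) v → v ∉ F
  Filled-∁⇒∉fort fort F⊆P (initial v∈∁P) v∈F = x∈∁p⇒x∉p v∈∁P (F⊆P v∈F)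
  Filled-∁⇒∉fort {F} fort F⊆P (force {u} {w} filled-u uw forced) w∈F =
    proj₂ fort u (Filled-∁⇒∉fort fort F⊆P filled-u) (x∈p⊆⁅x⁆⇒∣p∣≡1 (x∈p∩q⁺ (∈N⁺ uw , w∈F)) only-w)
    where
    only-w : N G u ∩ F ⊆ ⁅ w ⁆
    only-w {x} x∈Nu∩F with x ≟ w | x∈p∩q⁻ (N G u) F x∈Nu∩F
    ... | yes refl | _          = x∈⁅x⁆ w
    ... | no x≢w   | x∈Nu , x∈F = ⊥-elim (Filled-∁⇒∉fort fort F⊆P (forced x (∈N⁻ x∈Nu) x≢w) x∈F)

  fort⊆⇒¬zfs-∁ : ∀ {F P} → IsFort G F → F ⊆ P → ¬ IsZeroForcingSet G (∁ P)
  fort⊆⇒¬zfs-∁ fort F⊆P zfs = let (w , w∈F) = proj₁ fort in Filled-∁⇒∉fort fort F⊆P (zfs w) w∈F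

  module _ {B : Subset n} (filled? : Decidable (Filled G B)) where

    Unfilled : Subset n
    Unfilled = ⟦ ¬? ∘ filled? ⟧

    ∈Unfilled⁺ : ∀ {v} → ¬ Filled G B v → v ∈ Unfilled
    ∈Unfilled⁺ = ∈⟦⟧⁺ (¬? ∘ filled?)

    ∈Unfilled⁻ : ∀ {v} → v ∈ Unfilled → ¬ Filled G B v
    ∈Unfilled⁻ = ∈⟦⟧⁻ (¬? ∘ filled?)

    ∉Unfilled⇒Filled : ∀ {v} → v ∉ Unfilled → Filled G B v
    ∉Unfilled⇒Filled {v} v∉U with filled? v
    ... | yes filled-v = filled-v
    ... | no ¬filled-v = contradiction (∈Unfilled⁺ ¬filled-v) v∉U

    Unfilled-disjoint : ∀ {v} → v ∈ Unfilled → v ∉ B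
    Unfilled-disjoint v∈U v∈B = ∈Unfilled⁻ v∈U (initial v∈B)

    Unfilled-isFort : ¬ IsZeroForcingSet G B → IsFort G Unfilled
    Unfilled-isFort ¬zfs = nonempty , closed
      where
      nonempty : Nonempty Unfilled
      nonempty = let (v , ¬filled-v) = ¬∀⟶∃¬ n (Filled G B) filled? ¬zfs in v , ∈Unfilled⁺ ¬filled-v

      closed : ∀ v → v ∉ Unfilled → ∣ N G v ∩ Unfilled ∣ ≢ 1
      closed v v∉U |Nv∩U|≡1 with ∣p∣≡1⇒p≡⁅x⁆ (N G v ∩ Unfilled) |Nv∩U|≡1
      ... | w , Nv∩U≡⁅w⁆ = ∈Unfilled⁻ w∈U (force (∉Unfilled⇒Filled v∉U) (∈N⁻ w∈Nv) filled-others)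
        where
        w∈Nv∩U : w ∈ N G v ∩ Unfilled
        w∈Nv∩U = subst (w ∈_) (≡.sym Nv∩U≡⁅w⁆) (x∈⁅x⁆ w)
        w∈Nv : w ∈ N G v
        w∈Nv = proj₁ (x∈p∩q⁻ (N G v) Unfilled w∈Nv∩U)
        w∈U : w ∈ Unfilled
        w∈U = proj₂ (x∈p∩q⁻ (N G v) Unfilled w∈Nv∩U)
        filled-others : ∀ x → adj G v x ≡ true → x ≢ w → Filled G B x
        filled-others x vx x≢w = ∉Unfilled⇒Filled λ x∈U →
          x≢w (x∈⁅y⁆⇒x≡y w (subst (x ∈_) Nv∩U≡⁅w⁆ (x∈p∩q⁺ (∈N⁺ vx , x∈U))))

  failedPartition⇒forts : ∀ {P : Fin k → Subset n} →
    (filled? : ∀ i → Decidable (Filled G (∁ (P i)))) →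
    IsPartition G P → (∀ i → ¬ IsZeroForcingSet G (∁ (P i))) → HasDisjointForts G k
  failedPartition⇒forts {P = P} filled? (_ , disjoint , _) ¬zfs =
    (λ i → Unfilled (filled? i)) , (λ i → Unfilled-isFort (filled? i) (¬zfs i)) , forts-disjoint
    where
    Unfilled⊆P : ∀ i → Unfilled (filled? i) ⊆ P i
    Unfilled⊆P i v∈U = x∉∁p⇒x∈p (Unfilled-disjoint (filled? i) v∈U)

    forts-disjoint : PairwiseDisjoint G (λ i → Unfilled (filled? i))
    forts-disjoint i j i≢j (v , v∈Ui∩Uj) = let (v∈Ui , v∈Uj) = x∈p∩q⁻ _ _ v∈Ui∩Uj in
      disjoint i j i≢j (v , x∈p∩q⁺ (Unfilled⊆P i v∈Ui , Unfilled⊆P j v∈Uj))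

  failedPartition⇒¬¬forts : HasFailedZFPartition G k → ¬ ¬ HasDisjointForts G k
  failedPartition⇒¬¬forts (P , partition , ¬zfs) =
    ¬¬-map (λ filled? → failedPartition⇒forts filled? partition ¬zfs)
           (¬¬-∀-Fin λ i → ¬¬-∀-Fin λ v → ¬¬-excluded-middle)

  module _ {m} (F : Fin (suc m) → Subset n) (disjoint : PairwiseDisjoint G F) where

    owner : Fin n → Fin (suc m)
    owner v with any? (λ j → v ∈? F j)
    ... | yes (j , _) = j
    ... | no _        = zero

    owner-∈ : ∀ {v i} → v ∈ F i → owner v ≡ i
    owner-∈ {v} {i} v∈Fi with any? (λ j → v ∈? F j)
    ... | no ¬∃ = contradiction (i , v∈Fi) ¬∃
    ... | yes (j , v∈Fj) with j ≟ i
    ...   | yes j≡i = j≡i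
    ...   | no  j≢i = contradiction (v , x∈p∩q⁺ (v∈Fj , v∈Fi)) (disjoint j i j≢i)

    Part : Fin (suc m) → Subset n
    Part i = ⟦ (λ v → owner v ≟ i) ⟧

    ∈Part⁺ : ∀ {v i} → owner v ≡ i → v ∈ Part i
    ∈Part⁺ {i = i} = ∈⟦⟧⁺ (λ v → owner v ≟ i)

    ∈Part⁻ : ∀ {v i} → v ∈ Part i → owner v ≡ i
    ∈Part⁻ {i = i} = ∈⟦⟧⁻ (λ v → owner v ≟ i)

    Part-isPartition : (∀ i → Nonempty (F i)) → IsPartition G Part
    Part-isPartition nonempty = Part-nonempty , Part-disjoint , λ v → owner v , ∈Part⁺ refl
      where
      Part-nonempty : ∀ i → Nonempty (Part i)
      Part-nonempty i = let (v , v∈Fi) = nonempty i in v , ∈Part⁺ (owner-∈ v∈Fi)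

      Part-disjoint : PairwiseDisjoint G Part
      Part-disjoint i j i≢j (v , v∈Pi∩Pj) = let (v∈Pi , v∈Pj) = x∈p∩q⁻ _ _ v∈Pi∩Pj in
        i≢j (trans (≡.sym (∈Part⁻ v∈Pi)) (∈Part⁻ v∈Pj))

  forts⇒failedPartition : 1 ≤ k → HasDisjointForts G k → HasFailedZFPartition G k
  forts⇒failedPartition (s≤s _) (F , forts , disjoint) =
    Part F disjoint , Part-isPartition F disjoint (proj₁ ∘ forts) ,
    λ i → fort⊆⇒¬zfs-∁ (forts i) (∈Part⁺ F disjoint ∘ owner-∈ F disjoint)

  disjointForts⇒≤ : HasDisjointForts G k → k ≤ n
  disjointForts⇒≤ (F , forts , disjoint) = injective⇒≤ representative-injective
    where
    representative : Fin _ → Fin n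
    representative i = proj₁ (proj₁ (forts i))

    representative-injective : ∀ {i j} → representative i ≡ representative j → i ≡ j
    representative-injective {i} {j} rᵢ≡rⱼ with i ≟ j
    ... | yes i≡j = i≡j
    ... | no  i≢j = contradiction (representative i , x∈p∩q⁺ (proj₂ (proj₁ (forts i)) ,
                      subst (_∈ F j) (≡.sym rᵢ≡rⱼ) (proj₂ (proj₁ (forts j))))) (disjoint i j i≢j)

  isFort? : Decidable (IsFort G)
  isFort? F = nonempty? F ×-dec all? λ v → ¬? (v ∈? F) →-dec ¬? (∣ N G v ∩ F ∣ ≟ℕ 1)

  pairwiseDisjoint? : Decidable (PairwiseDisjoint G {k})
  pairwiseDisjoint? F = all? λ i → all? λ j → ¬? (i ≟ j) →-dec ¬? (nonempty? (F i ∩ F j))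

  hasDisjointForts? : Decidable (HasDisjointForts G)
  hasDisjointForts? k = Fin→-searchable anySubset? resp
    (λ F → all? (isFort? ∘ F) ×-dec pairwiseDisjoint? F)
    where
    resp : ∀ {F F′ : Fin k → Subset n} → F ≗ F′ →
           (∀ i → IsFort G (F i)) × PairwiseDisjoint G F →
           (∀ i → IsFort G (F′ i)) × PairwiseDisjoint G F′
    resp F≗F′ (forts , disjoint) =
      (λ i → subst (IsFort G) (F≗F′ i) (forts i)) ,
      (λ i j → subst₂ (λ p q → i ≢ j → Empty (p ∩ q)) (F≗F′ i) (F≗F′ j) (disjoint i j))

  ⊤-isFort : 1 ≤ n → IsFort G ⊤
  ⊤-isFort (s≤s _) = (zero , ∈⊤) , λ v v∉⊤ → contradiction ∈⊤ v∉⊤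

  hasOneFort : 1 ≤ n → HasDisjointForts G 1
  hasOneFort 1≤n = (λ _ → ⊤) , (λ _ → ⊤-isFort 1≤n) , λ { zero zero 0≢0 → contradiction refl 0≢0 }

  ft≡⇒z≡ : ∀ {m} → 1 ≤ n → ft≡ G m → z≡ G m
  ft≡⇒z≡ 1≤n (forts , maximal) =
    forts⇒failedPartition (maximal 1 (hasOneFort 1≤n)) forts ,
    λ k partition →
      maximal k (decidable-stable (hasDisjointForts? k) (failedPartition⇒¬¬forts partition))

corollary4p12 : (n : ℕ) (G : Graph (suc n)) → ∃ λ m → z≡ G m × ft≡ G m
corollary4p12 n G =
  let (m , ft≡m) = bounded⇒maximum (hasDisjointForts? G) (suc n) (disjointForts⇒≤ G)
                                    (1 , hasOneFort G (s≤s z≤n))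
  in m , ft≡⇒z≡ G (s≤s z≤n) ft≡m , ft≡m
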